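{- Let $B$ be the residue code of an extremal Type~II $\mathbb{Z}_4$-code of length $n$. If $n=32$ then $6\le \dim(B)\le 16$, and if $n=40$ then $7\le\dim(B)\le 20$.
   Context: $\mathbb{Z}_4$ is the ring of integers modulo $4$. A $\mathbb{Z}_4$-code of length $n$ is a $\mathbb{Z}_4$-submodule of $\mathbb{Z}_4^n$. The dual of $C$ is $C^\perp=\{x\in\mathbb{Z}_4^n : x\cdot y=0 \text{ for all } y\in C\}$ with $x\cdot y=\sum_i x_iy_i$; $C$ is self-dual if $C=C^\perp$. The Euclidean weight of $x\in\mathbb{Z}_4^n$ is $n_1(x)+4n_2(x)+n_3(x)$, where $n_\alpha(x)$ is the number of coordinates equal to $\alpha$. A $\mathbb{Z}_4$-code is Type~II if it is self-dual and all its codewords have Euclidean weight divisible by $8$. The minimum Euclidean weight $d_E$ of a Type~II code of length $n$ satisfies $d_E\le 8\lfloor n/24\rfloor+8$; a Type~II code attaining equality is called extremal. The residue code of $C$ is the binary code $C^{(1)}=\{c \bmod 2 : c\in C\}$; $\dim(B)$ denotes the dimension of a binary code $B$ over $\mathbb{F}_2$. -}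

module Defs where

open import Data.Nat using (ℕ; zero; suc; _+_; _*_; _≤_)
open import Data.Nat.DivMod using (_/_)
open import Data.Nat.Divisibility using (_∣_)
open import Data.Bool using (Bool; true; false; _xor_)
open import Data.Vec using (Vec; []; _∷_; zipWith; replicate; map; foldr)
open import Data.Product using (_×_; Σ; ∃; _,_)
open import Relation.Binary.PropositionalEquality using (_≡_)
open import Relation.Nullary using (¬_)

data ℤ₄ : Set where
  z0 z1 z2 z3 : ℤ₄

_+₄_ : ℤ₄ → ℤ₄ → ℤ₄
z0 +₄ y = y
z1 +₄ z0 = z1
z1 +₄ z1 = z2
z1 +₄ z2 = z3
z1 +₄ z3 = z0
z2 +₄ z0 = z2
z2 +₄ z1 = z3
z2 +₄ z2 = z0
z2 +₄ z3 = z1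
z3 +₄ z0 = z3
z3 +₄ z1 = z0
z3 +₄ z2 = z1
z3 +₄ z3 = z2

_*₄_ : ℤ₄ → ℤ₄ → ℤ₄
z0 *₄ y = z0
z1 *₄ y = y
z2 *₄ z0 = z0
z2 *₄ z1 = z2
z2 *₄ z2 = z0
z2 *₄ z3 = z2
z3 *₄ z0 = z0
z3 *₄ z1 = z3
z3 *₄ z2 = z2
z3 *₄ z3 = z1

Word₄ : ℕ → Set
Word₄ n = Vec ℤ₄ n

_⊕_ : ∀ {n} → Word₄ n → Word₄ n → Word₄ n
_⊕_ = zipWith _+₄_

_·ₛ_ : ∀ {n} → ℤ₄ → Word₄ n → Word₄ n
a ·ₛ x = map (a *₄_) x

zero₄ : ∀ {n} → Word₄ n
zero₄ = replicate _ z0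

dot : ∀ {n} → Word₄ n → Word₄ n → ℤ₄
dot x y = foldr _ _+₄_ z0 (zipWith _*₄_ x y)

record IsCode {n : ℕ} (C : Word₄ n → Set) : Set where
  field
    has-zero  : C zero₄
    closed-+  : ∀ x y → C x → C y → C (x ⊕ y)
    closed-·  : ∀ a x → C x → C (a ·ₛ x)

Dual : ∀ {n} → (Word₄ n → Set) → Word₄ n → Set
Dual C x = ∀ y → C y → dot x y ≡ z0

SelfDual : ∀ {n} → (Word₄ n → Set) → Set
SelfDual C = ∀ x → (C x → Dual C x) × (Dual C x → C x)

wE : ℤ₄ → ℕ
wE z0 = 0
wE z1 = 1
wE z2 = 4
wE z3 = 1

eucWt : ∀ {n} → Word₄ n → ℕ
eucWt x = foldr _ _+_ 0 (map wE x)

IsTypeII : ∀ {n} → (Word₄ n → Set) → Set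
IsTypeII C = IsCode C × SelfDual C × (∀ x → C x → 8 ∣ eucWt x)

MinEucWt : ∀ {n} → (Word₄ n → Set) → ℕ → Set
MinEucWt C d =
  (Σ _ λ x → C x × ¬ (x ≡ zero₄) × eucWt x ≡ d)
  × (∀ x → C x → ¬ (x ≡ zero₄) → d ≤ eucWt x)

IsExtremalTypeII : ∀ {n} → (Word₄ n → Set) → Set
IsExtremalTypeII {n} C = IsTypeII C × MinEucWt C (8 * (n / 24) + 8)

Word₂ : ℕ → Set
Word₂ n = Vec Bool n

zero₂ : ∀ {n} → Word₂ n
zero₂ = replicate _ false

_⊕₂_ : ∀ {n} → Word₂ n → Word₂ n → Word₂ n
_⊕₂_ = zipWith _xor_

mod2 : ℤ₄ → Bool
mod2 z0 = false
mod2 z1 = true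
mod2 z2 = false
mod2 z3 = true

Residue : ∀ {n} → (Word₄ n → Set) → Word₂ n → Set
Residue C b = Σ _ λ c → C c × map mod2 c ≡ b

linComb : ∀ {n k} → Vec Bool k → Vec (Word₂ n) k → Word₂ n
linComb [] [] = zero₂
linComb (false ∷ as) (v ∷ vs) = linComb as vs
linComb (true ∷ as) (v ∷ vs) = v ⊕₂ linComb as vs

HasDim : ∀ {n} → (Word₂ n → Set) → ℕ → Set
HasDim {n} B k = Σ (Vec (Word₂ n) k) λ vs →
  (∀ a → linComb a vs ≡ zero₂ → a ≡ replicate k false)
  × (∀ b → B b → ∃ λ a → linComb a vs ≡ b)
  × (∀ a → B (linComb a vs))

-- Upper bound: the residue code B of a self-dual code is self-orthogonal, so a basis of B and
-- that same basis are two independent mutually orthogonal families, and Gaussian elimination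
-- shows that such families have at most n members altogether; hence 2 dim B ≤ n.
--
-- Lower bound: if t ∈ B⊥ then 2t ∈ C, and 2t has Euclidean weight 4 wt(t). Since d_E = 16 for
-- n = 32 and n = 40, B⊥ has minimum weight at least 4. In a generator matrix of B this means no
-- three columns h_i sum to zero, so the 2n vectors h_i and h_i + h_0 are pairwise distinct
-- (parity keeps the two halves apart) and 2n ≤ 2^dim B.
module Submission where

open import Defs
open import Algebra.Bundles using (CommutativeRing)
open import Data.Bool using (Bool; true; false; _xor_; _∧_)
open import Data.Bool.Properties
  using ( xor-∧-commutativeRing; xor-comm; xor-assoc; xor-same; xor-identityˡ; xor-identityʳ
        ; ∧-comm; ∧-identityʳ; ∧-zeroʳ; ∧-distribʳ-xor)
  renaming (_≟_ to _≟ᵇ_)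
open import Algebra.Properties.CommutativeSemigroup
  (CommutativeRing.+-commutativeSemigroup xor-∧-commutativeRing)
  using (x∙yz≈y∙xz) renaming (interchange to xor-interchange)
open import Data.Fin using (Fin; zero; suc; combine; splitAt)
open import Data.Fin.Properties using (combine-injective; injective⇒≤; +↔⊎)
open import Data.Fin.Subset using (⁅_⁆; ∣_∣; _∈_)
open import Data.Fin.Subset.Properties
  using (x∈⁅x⁆; x∈⁅y⁆⇒x≡y; ∣⁅x⁆∣≡1; nonempty?; Empty-unique)
open import Data.Nat using (ℕ; zero; suc; _+_; _*_; _^_; _≤_; _<_; z≤n; s≤s; z<s)
open import Data.Nat.DivMod using (_/_)
open import Data.Nat.Properties
open import Data.Product using (_×_; ∃; _,_; proj₁; proj₂; map₂)
open import Data.Sum using (_⊎_; inj₁; inj₂)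
open import Data.Vec using (Vec; []; _∷_; zipWith; replicate; map; foldr; lookup; removeAt; tail)
open import Data.Vec.Properties
  using ( lookup-map; lookup-replicate; lookup-zipWith; zipWith-comm; zipWith-assoc
        ; zipWith-identityˡ; zipWith-identityʳ; ∷-injectiveˡ; ∷-injectiveʳ; ≡-dec; []=⇒lookup)
open import Function using (_∘_)
open import Function.Bundles using (Injection)
open import Function.Properties.Inverse using (↔⇒↣)
open import Relation.Nullary using (contradiction)
open import Relation.Nullary.Decidable using (decidable-stable)
open import Relation.Binary.PropositionalEquality

⊕₂-comm : ∀ {n} (x y : Word₂ n) → x ⊕₂ y ≡ y ⊕₂ x
⊕₂-comm = zipWith-comm xor-comm

⊕₂-assoc : ∀ {n} (x y z : Word₂ n) → (x ⊕₂ y) ⊕₂ z ≡ x ⊕₂ (y ⊕₂ z)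
⊕₂-assoc = zipWith-assoc xor-assoc

⊕₂-identityˡ : ∀ {n} (x : Word₂ n) → zero₂ ⊕₂ x ≡ x
⊕₂-identityˡ = zipWith-identityˡ xor-identityˡ

⊕₂-identityʳ : ∀ {n} (x : Word₂ n) → x ⊕₂ zero₂ ≡ x
⊕₂-identityʳ = zipWith-identityʳ xor-identityʳ

⊕₂-self : ∀ {n} (x : Word₂ n) → x ⊕₂ x ≡ zero₂
⊕₂-self []      = refl
⊕₂-self (b ∷ x) = cong₂ _∷_ (xor-same b) (⊕₂-self x)

⊕₂-interchange : ∀ {n} (x y z w : Word₂ n) → (x ⊕₂ y) ⊕₂ (z ⊕₂ w) ≡ (x ⊕₂ z) ⊕₂ (y ⊕₂ w)
⊕₂-interchange []      []      []      []      = refl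
⊕₂-interchange (a ∷ x) (b ∷ y) (c ∷ z) (d ∷ w) =
  cong₂ _∷_ (xor-interchange a b c d) (⊕₂-interchange x y z w)

x⊕y⊕y≡x : ∀ {n} (x y : Word₂ n) → (x ⊕₂ y) ⊕₂ y ≡ x
x⊕y⊕y≡x x y = begin
  (x ⊕₂ y) ⊕₂ y   ≡⟨ ⊕₂-assoc x y y ⟩
  x ⊕₂ (y ⊕₂ y)   ≡⟨ cong (x ⊕₂_) (⊕₂-self y) ⟩
  x ⊕₂ zero₂      ≡⟨ ⊕₂-identityʳ x ⟩
  x               ∎
  where open ≡-Reasoning

⊕₂-cancelʳ : ∀ {n} (x y z : Word₂ n) → x ⊕₂ z ≡ y ⊕₂ z → x ≡ y
⊕₂-cancelʳ x y z e = begin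
  x               ≡⟨ x⊕y⊕y≡x x z ⟨
  (x ⊕₂ z) ⊕₂ z   ≡⟨ cong (_⊕₂ z) e ⟩
  (y ⊕₂ z) ⊕₂ z   ≡⟨ x⊕y⊕y≡x y z ⟩
  y               ∎
  where open ≡-Reasoning

x⊕y≡zero⇒x≡y : ∀ {n} (x y : Word₂ n) → x ⊕₂ y ≡ zero₂ → x ≡ y
x⊕y≡zero⇒x≡y x y e = ⊕₂-cancelʳ x y y (trans e (sym (⊕₂-self y)))

scale : ∀ {n} → Bool → Word₂ n → Word₂ n
scale true  v = v
scale false v = zero₂

scale-xor : ∀ {n} a b (v : Word₂ n) → scale (a xor b) v ≡ scale a v ⊕₂ scale b v
scale-xor true  true  v = sym (⊕₂-self v)
scale-xor true  false v = sym (⊕₂-identityʳ v)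
scale-xor false b     v = sym (⊕₂-identityˡ (scale b v))

lookup-scale : ∀ {n} c {v : Word₂ n} {p} → lookup v p ≡ true → lookup (scale c v) p ≡ c
lookup-scale true            vₚ = vₚ
lookup-scale false {p = p} _  = lookup-replicate p false

lookup-⊕₂ : ∀ {n} (x y : Word₂ n) p → lookup (x ⊕₂ y) p ≡ lookup x p xor lookup y p
lookup-⊕₂ x y p = lookup-zipWith _xor_ p x y

linComb-∷ : ∀ {n k} b a (v : Word₂ n) (vs : Vec (Word₂ n) k) →
            linComb (b ∷ a) (v ∷ vs) ≡ scale b v ⊕₂ linComb a vs
linComb-∷ true  a v vs = refl
linComb-∷ false a v vs = sym (⊕₂-identityˡ (linComb a vs))

linComb-zero : ∀ {n k} (vs : Vec (Word₂ n) k) → linComb (replicate k false) vs ≡ zero₂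
linComb-zero []       = refl
linComb-zero (v ∷ vs) = linComb-zero vs

linComb-⁅⁆ : ∀ {n k} (vs : Vec (Word₂ n) k) j → linComb ⁅ j ⁆ vs ≡ lookup vs j
linComb-⁅⁆ (v ∷ vs) zero    = trans (cong (v ⊕₂_) (linComb-zero vs)) (⊕₂-identityʳ v)
linComb-⁅⁆ (v ∷ vs) (suc j) = linComb-⁅⁆ vs j

record IsLinear {m n} (f : Word₂ m → Word₂ n) : Set where
  field
    preserves-zero : f zero₂ ≡ zero₂
    preserves-⊕    : ∀ x y → f (x ⊕₂ y) ≡ f x ⊕₂ f y

linComb-map : ∀ {m n k} {f : Word₂ m → Word₂ n} → IsLinear f →
              ∀ a (vs : Vec (Word₂ m) k) → linComb a (map f vs) ≡ f (linComb a vs)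
linComb-map lin []          []       = sym (IsLinear.preserves-zero lin)
linComb-map lin (false ∷ a) (v ∷ vs) = linComb-map lin a vs
linComb-map {f = f} lin (true ∷ a) (v ∷ vs) =
  trans (cong (f v ⊕₂_) (linComb-map lin a vs))
        (sym (IsLinear.preserves-⊕ lin v (linComb a vs)))

∘-isLinear : ∀ {l m n} {f : Word₂ m → Word₂ n} {g : Word₂ l → Word₂ m} →
             IsLinear f → IsLinear g → IsLinear (f ∘ g)
∘-isLinear {f = f} {g} F G = record
  { preserves-zero = trans (cong f (IsLinear.preserves-zero G)) (IsLinear.preserves-zero F)
  ; preserves-⊕    = λ x y →
      trans (cong f (IsLinear.preserves-⊕ G x y)) (IsLinear.preserves-⊕ F (g x) (g y))
  }

-- Binary inner product and Hamming weight; a word doubles as the subset of its support, so the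
-- unit vector is ⁅ i ⁆ and the Hamming weight is ∣_∣.

dot₂ : ∀ {n} → Word₂ n → Word₂ n → Bool
dot₂ x y = foldr _ _xor_ false (zipWith _∧_ x y)

dot₂-comm : ∀ {n} (x y : Word₂ n) → dot₂ x y ≡ dot₂ y x
dot₂-comm []      []      = refl
dot₂-comm (a ∷ x) (b ∷ y) = cong₂ _xor_ (∧-comm a b) (dot₂-comm x y)

dot₂-zeroˡ : ∀ {n} (y : Word₂ n) → dot₂ zero₂ y ≡ false
dot₂-zeroˡ []      = refl
dot₂-zeroˡ (b ∷ y) = dot₂-zeroˡ y

dot₂-⊕ˡ : ∀ {n} (x y z : Word₂ n) → dot₂ (x ⊕₂ y) z ≡ dot₂ x z xor dot₂ y z
dot₂-⊕ˡ []      []      []      = refl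
dot₂-⊕ˡ (a ∷ x) (b ∷ y) (c ∷ z) =
  trans (cong₂ _xor_ (∧-distribʳ-xor c a b) (dot₂-⊕ˡ x y z))
        (xor-interchange (a ∧ c) (b ∧ c) (dot₂ x z) (dot₂ y z))

dot₂-⊕ʳ : ∀ {n} (x y z : Word₂ n) → dot₂ x (y ⊕₂ z) ≡ dot₂ x y xor dot₂ x z
dot₂-⊕ʳ x y z = begin
  dot₂ x (y ⊕₂ z)          ≡⟨ dot₂-comm x (y ⊕₂ z) ⟩
  dot₂ (y ⊕₂ z) x          ≡⟨ dot₂-⊕ˡ y z x ⟩
  dot₂ y x xor dot₂ z x    ≡⟨ cong₂ _xor_ (dot₂-comm y x) (dot₂-comm z x) ⟩
  dot₂ x y xor dot₂ x z    ∎
  where open ≡-Reasoning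

dot₂-scaleˡ : ∀ {n} c (v w : Word₂ n) → dot₂ (scale c v) w ≡ c ∧ dot₂ v w
dot₂-scaleˡ true  v w = refl
dot₂-scaleˡ false v w = dot₂-zeroˡ w

dot₂-⁅⁆ˡ : ∀ {n} (i : Fin n) (y : Word₂ n) → dot₂ ⁅ i ⁆ y ≡ lookup y i
dot₂-⁅⁆ˡ zero    (b ∷ y) = trans (cong (b xor_) (dot₂-zeroˡ y)) (xor-identityʳ b)
dot₂-⁅⁆ˡ (suc i) (b ∷ y) = dot₂-⁅⁆ˡ i y

linComb-orthogonal : ∀ {n k} a (vs : Vec (Word₂ n) k) w →
                     (∀ i → dot₂ (lookup vs i) w ≡ false) → dot₂ (linComb a vs) w ≡ false
linComb-orthogonal []          []       w _  = dot₂-zeroˡ w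
linComb-orthogonal (false ∷ a) (v ∷ vs) w ⊥w = linComb-orthogonal a vs w (⊥w ∘ suc)
linComb-orthogonal (true ∷ a)  (v ∷ vs) w ⊥w =
  trans (dot₂-⊕ˡ v (linComb a vs) w)
        (cong₂ _xor_ (⊥w zero) (linComb-orthogonal a vs w (⊥w ∘ suc)))

∣x⊕y∣≤∣x∣+∣y∣ : ∀ {n} (x y : Word₂ n) → ∣ x ⊕₂ y ∣ ≤ ∣ x ∣ + ∣ y ∣
∣x⊕y∣≤∣x∣+∣y∣ []          []          = z≤n
∣x⊕y∣≤∣x∣+∣y∣ (true ∷ x)  (true ∷ y)  =
  ≤-trans (∣x⊕y∣≤∣x∣+∣y∣ x y) (+-mono-≤ (n≤1+n ∣ x ∣) (n≤1+n ∣ y ∣))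
∣x⊕y∣≤∣x∣+∣y∣ (true ∷ x)  (false ∷ y) = s≤s (∣x⊕y∣≤∣x∣+∣y∣ x y)
∣x⊕y∣≤∣x∣+∣y∣ (false ∷ x) (true ∷ y)  =
  subst (suc ∣ x ⊕₂ y ∣ ≤_) (sym (+-suc ∣ x ∣ ∣ y ∣)) (s≤s (∣x⊕y∣≤∣x∣+∣y∣ x y))
∣x⊕y∣≤∣x∣+∣y∣ (false ∷ x) (false ∷ y) = ∣x⊕y∣≤∣x∣+∣y∣ x y

∣⁅i⁆⊕x∣≤1+∣x∣ : ∀ {n} (i : Fin n) (x : Word₂ n) → ∣ ⁅ i ⁆ ⊕₂ x ∣ ≤ suc ∣ x ∣
∣⁅i⁆⊕x∣≤1+∣x∣ i x = ≤-trans (∣x⊕y∣≤∣x∣+∣y∣ ⁅ i ⁆ x) (≤-reflexive (cong (_+ ∣ x ∣) (∣⁅x⁆∣≡1 i)))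

∣⁅i⁆⊕⁅j⁆∣≤2 : ∀ {n} (i j : Fin n) → ∣ ⁅ i ⁆ ⊕₂ ⁅ j ⁆ ∣ ≤ 2
∣⁅i⁆⊕⁅j⁆∣≤2 i j = ≤-trans (∣⁅i⁆⊕x∣≤1+∣x∣ i ⁅ j ⁆) (s≤s (≤-reflexive (∣⁅x⁆∣≡1 j)))

Independent : ∀ {n k} → Vec (Word₂ n) k → Set
Independent {k = k} vs = ∀ a → linComb a vs ≡ zero₂ → a ≡ replicate k false

Orthogonal : ∀ {n k m} → Vec (Word₂ n) k → Vec (Word₂ n) m → Set
Orthogonal vs ws = ∀ i j → dot₂ (lookup vs i) (lookup ws j) ≡ false

independent⇒head≢zero : ∀ {n k} {v : Word₂ n} (vs : Vec (Word₂ n) k) →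
                        Independent (v ∷ vs) → v ≢ zero₂
independent⇒head≢zero {v = v} vs independent v≡0
  with independent ⁅ zero ⁆ (trans (linComb-⁅⁆ (v ∷ vs) zero) v≡0)
... | ()

pivot : ∀ {n} (v : Word₂ n) → v ≢ zero₂ → ∃ λ p → lookup v p ≡ true
pivot v v≢0 = map₂ []=⇒lookup (decidable-stable (nonempty? v) (v≢0 ∘ Empty-unique))

puncture : ∀ {n} → Fin (suc n) → Word₂ (suc n) → Word₂ n
puncture p x = removeAt x p

puncture-isLinear : ∀ {n} (p : Fin (suc n)) → IsLinear (puncture p)
puncture-isLinear p = record { preserves-zero = zero-case p ; preserves-⊕ = ⊕-case p }
  where
  zero-case : ∀ {n} (p : Fin (suc n)) → puncture p zero₂ ≡ zero₂
  zero-case         zero    = refl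
  zero-case {suc n} (suc p) = cong (false ∷_) (zero-case p)
  ⊕-case : ∀ {n} (p : Fin (suc n)) (x y : Word₂ (suc n)) →
           puncture p (x ⊕₂ y) ≡ puncture p x ⊕₂ puncture p y
  ⊕-case zero    (a ∷ x)         (b ∷ y)         = refl
  ⊕-case (suc p) (a ∷ x@(_ ∷ _)) (b ∷ y@(_ ∷ _)) = cong ((a xor b) ∷_) (⊕-case p x y)

puncture-zero : ∀ {n} (p : Fin (suc n)) (x : Word₂ (suc n)) →
                lookup x p ≡ false → puncture p x ≡ zero₂ → x ≡ zero₂
puncture-zero zero    (a ∷ x)         xₚ e = cong₂ _∷_ xₚ e
puncture-zero (suc p) (a ∷ x@(_ ∷ _)) xₚ e =
  cong₂ _∷_ (∷-injectiveˡ e) (puncture-zero p x xₚ (∷-injectiveʳ e))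

dot₂-puncture : ∀ {n} (p : Fin (suc n)) (x y : Word₂ (suc n)) →
                dot₂ x y ≡ (lookup x p ∧ lookup y p) xor dot₂ (puncture p x) (puncture p y)
dot₂-puncture zero    (a ∷ x)         (b ∷ y)         = refl
dot₂-puncture (suc p) (a ∷ x@(_ ∷ _)) (b ∷ y@(_ ∷ _)) =
  trans (cong ((a ∧ b) xor_) (dot₂-puncture p x y))
        (x∙yz≈y∙xz (a ∧ b) (lookup x p ∧ lookup y p) (dot₂ (puncture p x) (puncture p y)))

dot₂-supported : ∀ {n} (p : Fin (suc n)) (x y : Word₂ (suc n)) →
                 puncture p x ≡ zero₂ → dot₂ x y ≡ lookup x p ∧ lookup y p
dot₂-supported p x y e = begin
  dot₂ x y                                        ≡⟨ dot₂-puncture p x y ⟩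
  xₚyₚ xor dot₂ (puncture p x) (puncture p y)     ≡⟨ cong (λ z → xₚyₚ xor dot₂ z (puncture p y)) e ⟩
  xₚyₚ xor dot₂ zero₂ (puncture p y)              ≡⟨ cong (xₚyₚ xor_) (dot₂-zeroˡ (puncture p y)) ⟩
  xₚyₚ xor false                                  ≡⟨ xor-identityʳ xₚyₚ ⟩
  xₚyₚ                                            ∎
  where
  open ≡-Reasoning
  xₚyₚ = lookup x p ∧ lookup y p

dot₂-unsupported : ∀ {n} (p : Fin (suc n)) (x y : Word₂ (suc n)) →
                   lookup x p ≡ false → dot₂ x y ≡ dot₂ (puncture p x) (puncture p y)
dot₂-unsupported p x y xₚ =
  trans (dot₂-puncture p x y)
        (cong (λ b → (b ∧ lookup y p) xor dot₂ (puncture p x) (puncture p y)) xₚ)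

module Elimination {n} (p : Fin (suc n)) (v : Word₂ (suc n)) (vₚ : lookup v p ≡ true) where

  clear : Word₂ (suc n) → Word₂ (suc n)
  clear u = u ⊕₂ scale (lookup u p) v

  lookup-clear : ∀ u → lookup (clear u) p ≡ false
  lookup-clear u = begin
    lookup (clear u) p                 ≡⟨ lookup-⊕₂ u _ p ⟩
    uₚ xor lookup (scale uₚ v) p       ≡⟨ cong (uₚ xor_) (lookup-scale uₚ vₚ) ⟩
    uₚ xor uₚ                          ≡⟨ xor-same uₚ ⟩
    false                              ∎
    where
    open ≡-Reasoning
    uₚ = lookup u p

  clear-isLinear : IsLinear clear
  clear-isLinear = record
    { preserves-zero =
        trans (cong (λ b → zero₂ ⊕₂ scale b v) (lookup-replicate p false)) (⊕₂-self zero₂)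
    ; preserves-⊕ = λ x y → begin
        (x ⊕₂ y) ⊕₂ scale (lookup (x ⊕₂ y) p) v
          ≡⟨ cong (λ b → (x ⊕₂ y) ⊕₂ scale b v) (lookup-⊕₂ x y p) ⟩
        (x ⊕₂ y) ⊕₂ scale (lookup x p xor lookup y p) v
          ≡⟨ cong ((x ⊕₂ y) ⊕₂_) (scale-xor (lookup x p) (lookup y p) v) ⟩
        (x ⊕₂ y) ⊕₂ (scale (lookup x p) v ⊕₂ scale (lookup y p) v)
          ≡⟨ ⊕₂-interchange x y _ _ ⟩
        clear x ⊕₂ clear y
          ∎
    }
    where open ≡-Reasoning

  reduce : Word₂ (suc n) → Word₂ n
  reduce = puncture p ∘ clear

  reduce-independent : ∀ {k} (vs : Vec (Word₂ (suc n)) k) →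
                       Independent (v ∷ vs) → Independent (map reduce vs)
  reduce-independent vs independent a e = cong tail (independent (c ∷ a) combination≡zero)
    where
    c = lookup (linComb a vs) p
    clear≡zero : clear (linComb a vs) ≡ zero₂
    clear≡zero = puncture-zero p _ (lookup-clear (linComb a vs))
      (trans (sym (linComb-map (∘-isLinear (puncture-isLinear p) clear-isLinear) a vs)) e)
    combination≡zero : linComb (c ∷ a) (v ∷ vs) ≡ zero₂
    combination≡zero = trans (linComb-∷ c a v vs) (trans (⊕₂-comm (scale c v) _) clear≡zero)

  puncture-independent : ∀ {m} (ws : Vec (Word₂ (suc n)) m) → Independent ws →
                         (∀ j → dot₂ v (lookup ws j) ≡ false) → Independent (map (puncture p) ws)
  puncture-independent ws independent v⊥ b e = independent b (puncture-zero p x xₚ≡false x′≡zero)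
    where
    x  = linComb b ws
    x′≡zero : puncture p x ≡ zero₂
    x′≡zero = trans (sym (linComb-map (puncture-isLinear p) b ws)) e
    xₚ≡false : lookup x p ≡ false
    xₚ≡false = begin
      lookup x p                ≡⟨ ∧-identityʳ (lookup x p) ⟨
      lookup x p ∧ true         ≡⟨ cong (lookup x p ∧_) vₚ ⟨
      lookup x p ∧ lookup v p   ≡⟨ dot₂-supported p x v x′≡zero ⟨
      dot₂ x v                  ≡⟨ linComb-orthogonal b ws v (λ j → trans (dot₂-comm _ v) (v⊥ j)) ⟩
      false                     ∎
      where open ≡-Reasoning

  reduce-orthogonal : ∀ {k m} (vs : Vec (Word₂ (suc n)) k) (ws : Vec (Word₂ (suc n)) m) →
                      Orthogonal (v ∷ vs) ws → Orthogonal (map reduce vs) (map (puncture p) ws)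
  reduce-orthogonal vs ws orthogonal i j = begin
    dot₂ (lookup (map reduce vs) i) (lookup (map (puncture p) ws) j)
      ≡⟨ cong₂ dot₂ (lookup-map i reduce vs) (lookup-map j (puncture p) ws) ⟩
    dot₂ (reduce u) (puncture p w)
      ≡⟨ dot₂-unsupported p (clear u) w (lookup-clear u) ⟨
    dot₂ (clear u) w
      ≡⟨ dot₂-⊕ˡ u _ w ⟩
    dot₂ u w xor dot₂ (scale uₚ v) w
      ≡⟨ cong₂ _xor_ (orthogonal (suc i) j) (dot₂-scaleˡ uₚ v w) ⟩
    uₚ ∧ dot₂ v w
      ≡⟨ cong (uₚ ∧_) (orthogonal zero j) ⟩
    uₚ ∧ false
      ≡⟨ ∧-zeroʳ uₚ ⟩
    false
      ∎
    where
    open ≡-Reasoning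
    u = lookup vs i
    w = lookup ws j
    uₚ = lookup u p

independent-orthogonal⇒≤ : ∀ n {k m} (vs : Vec (Word₂ n) k) (ws : Vec (Word₂ n) m) →
                           Independent vs → Independent ws → Orthogonal vs ws → k + m ≤ n
independent∷-orthogonal⇒< : ∀ n {k m} (v : Word₂ n) (vs : Vec (Word₂ n) k) (ws : Vec (Word₂ n) m) →
                            Independent (v ∷ vs) → Independent ws → Orthogonal (v ∷ vs) ws →
                            suc k + m ≤ n

independent-orthogonal⇒≤ n []       []       _  _  _ = z≤n
independent-orthogonal⇒≤ n []       (w ∷ ws) _  iw _ = subst (_≤ n) (+-identityʳ _)
  (independent∷-orthogonal⇒< n w ws [] iw (λ { [] _ → refl }) (λ _ ()))
independent-orthogonal⇒≤ n (v ∷ vs) ws       iv iw o = independent∷-orthogonal⇒< n v vs ws iv iw o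

independent∷-orthogonal⇒< zero    [] vs ws iv _ _ = contradiction refl (independent⇒head≢zero vs iv)
independent∷-orthogonal⇒< (suc n) v  vs ws iv iw o with pivot v (independent⇒head≢zero vs iv)
... | p , vₚ = s≤s (independent-orthogonal⇒≤ n (map reduce vs) (map (puncture p) ws)
                     (reduce-independent vs iv)
                     (puncture-independent ws iw (o zero))
                     (reduce-orthogonal vs ws o))
  where open Elimination p v vₚ

syndrome : ∀ {n k} → Vec (Word₂ n) k → Word₂ n → Word₂ k
syndrome vs t = map (λ v → dot₂ v t) vs

syndrome-⊕ : ∀ {n k} (vs : Vec (Word₂ n) k) x y →
             syndrome vs (x ⊕₂ y) ≡ syndrome vs x ⊕₂ syndrome vs y
syndrome-⊕ []       x y = refl
syndrome-⊕ (v ∷ vs) x y = cong₂ _∷_ (dot₂-⊕ʳ v x y) (syndrome-⊕ vs x y)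

DualDistance≥4 : ∀ {n k} → Vec (Word₂ n) k → Set
DualDistance≥4 {n} vs = ∀ (t : Word₂ n) → syndrome vs t ≡ zero₂ → ∣ t ∣ ≤ 3 → t ≡ zero₂

bitToFin : Bool → Fin 2
bitToFin false = zero
bitToFin true  = suc zero

bitToFin-injective : ∀ a b → bitToFin a ≡ bitToFin b → a ≡ b
bitToFin-injective false false _ = refl
bitToFin-injective true  true  _ = refl

toFin : ∀ {k} → Word₂ k → Fin (2 ^ k)
toFin []      = zero
toFin (b ∷ x) = combine (bitToFin b) (toFin x)

toFin-injective : ∀ {k} (x y : Word₂ k) → toFin x ≡ toFin y → x ≡ y
toFin-injective []      []      _ = refl
toFin-injective (a ∷ x) (b ∷ y) e =
  let a≡b , x≡y = combine-injective (bitToFin a) (toFin x) (bitToFin b) (toFin y) e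
  in cong₂ _∷_ (bitToFin-injective a b a≡b) (toFin-injective x y x≡y)

module ColumnCount {n k} (vs : Vec (Word₂ (suc n)) k) (dualDistance≥4 : DualDistance≥4 vs) where

  column : Fin (suc n) → Word₂ k
  column i = syndrome vs ⁅ i ⁆

  column-injective : ∀ {i j} → column i ≡ column j → i ≡ j
  column-injective {i} {j} e = x∈⁅y⁆⇒x≡y j (subst (i ∈_) ⁅i⁆≡⁅j⁆ (x∈⁅x⁆ i))
    where
    ⁅i⁆≡⁅j⁆ : ⁅ i ⁆ ≡ ⁅ j ⁆
    ⁅i⁆≡⁅j⁆ = x⊕y≡zero⇒x≡y ⁅ i ⁆ ⁅ j ⁆ (dualDistance≥4 (⁅ i ⁆ ⊕₂ ⁅ j ⁆)
      (trans (syndrome-⊕ vs ⁅ i ⁆ ⁅ j ⁆) (trans (cong (_⊕₂ column j) e) (⊕₂-self (column j))))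
      (m≤n⇒m≤1+n (∣⁅i⁆⊕⁅j⁆∣≤2 i j)))

  -- The word ⁅ i ⁆ ⊕ ⁅ j ⁆ ⊕ ⁅ l ⁆ has odd weight, so it is nonzero even if i, j, l coincide.
  column≢sum : ∀ i j l → column i ≢ column j ⊕₂ column l
  column≢sum i j l e = contradiction t≡zero t≢zero
    where
    t = ⁅ i ⁆ ⊕₂ (⁅ j ⁆ ⊕₂ ⁅ l ⁆)
    ones = replicate (suc n) true
    parity : Word₂ (suc n) → Bool
    parity x = dot₂ x ones
    parity-⁅⁆ : ∀ r → parity ⁅ r ⁆ ≡ true
    parity-⁅⁆ r = trans (dot₂-⁅⁆ˡ r ones) (lookup-replicate r true)
    parity-t : parity t ≡ true
    parity-t = trans (dot₂-⊕ˡ ⁅ i ⁆ _ _) (cong₂ _xor_ (parity-⁅⁆ i)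
                 (trans (dot₂-⊕ˡ ⁅ j ⁆ ⁅ l ⁆ _) (cong₂ _xor_ (parity-⁅⁆ j) (parity-⁅⁆ l))))
    syndrome≡zero : syndrome vs t ≡ zero₂
    syndrome≡zero = begin
      syndrome vs t                                      ≡⟨ syndrome-⊕ vs ⁅ i ⁆ _ ⟩
      column i ⊕₂ syndrome vs (⁅ j ⁆ ⊕₂ ⁅ l ⁆)           ≡⟨ cong₂ _⊕₂_ e (syndrome-⊕ vs ⁅ j ⁆ ⁅ l ⁆) ⟩
      (column j ⊕₂ column l) ⊕₂ (column j ⊕₂ column l)   ≡⟨ ⊕₂-self _ ⟩
      zero₂                                              ∎
      where open ≡-Reasoning
    weight≤3 : ∣ t ∣ ≤ 3
    weight≤3 = ≤-trans (∣⁅i⁆⊕x∣≤1+∣x∣ i _) (s≤s (∣⁅i⁆⊕⁅j⁆∣≤2 j l))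
    t≡zero : t ≡ zero₂
    t≡zero = dualDistance≥4 t syndrome≡zero weight≤3
    t≢zero : t ≢ zero₂
    t≢zero t≡0 with trans (sym parity-t) (trans (cong parity t≡0) (dot₂-zeroˡ ones))
    ... | ()

  encode : Fin (suc n) ⊎ Fin (suc n) → Word₂ k
  encode (inj₁ i) = column i
  encode (inj₂ i) = column i ⊕₂ column zero

  encode-injective : ∀ x y → encode x ≡ encode y → x ≡ y
  encode-injective (inj₁ i) (inj₁ j) e = cong inj₁ (column-injective e)
  encode-injective (inj₂ i) (inj₂ j) e =
    cong inj₂ (column-injective (⊕₂-cancelʳ _ _ (column zero) e))
  encode-injective (inj₁ i) (inj₂ j) e = contradiction e (column≢sum i j zero)
  encode-injective (inj₂ i) (inj₁ j) e = contradiction (sym e) (column≢sum j i zero)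

dualDistance≥4⇒2n≤2^k : ∀ {n k} (vs : Vec (Word₂ n) k) → DualDistance≥4 vs → n + n ≤ 2 ^ k
dualDistance≥4⇒2n≤2^k {zero}  vs _              = z≤n
dualDistance≥4⇒2n≤2^k {suc n} vs dualDistance≥4 =
  injective⇒≤ {f = toFin ∘ encode ∘ splitAt (suc n)} λ e →
    Injection.injective (↔⇒↣ +↔⊎) (encode-injective _ _ (toFin-injective _ _ e))
  where open ColumnCount vs dualDistance≥4

double : Bool → ℤ₄
double false = z0
double true  = z2

mod2-+₄ : ∀ a b → mod2 (a +₄ b) ≡ mod2 a xor mod2 b
mod2-+₄ z0 b  = refl
mod2-+₄ z1 z0 = refl
mod2-+₄ z1 z1 = refl
mod2-+₄ z1 z2 = refl
mod2-+₄ z1 z3 = refl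
mod2-+₄ z2 z0 = refl
mod2-+₄ z2 z1 = refl
mod2-+₄ z2 z2 = refl
mod2-+₄ z2 z3 = refl
mod2-+₄ z3 z0 = refl
mod2-+₄ z3 z1 = refl
mod2-+₄ z3 z2 = refl
mod2-+₄ z3 z3 = refl

mod2-*₄ : ∀ a b → mod2 (a *₄ b) ≡ mod2 a ∧ mod2 b
mod2-*₄ z0 b  = refl
mod2-*₄ z1 b  = refl
mod2-*₄ z2 z0 = refl
mod2-*₄ z2 z1 = refl
mod2-*₄ z2 z2 = refl
mod2-*₄ z2 z3 = refl
mod2-*₄ z3 z0 = refl
mod2-*₄ z3 z1 = refl
mod2-*₄ z3 z2 = refl
mod2-*₄ z3 z3 = refl

double-+₄ : ∀ a b → double a +₄ double b ≡ double (a xor b)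
double-+₄ false b     = refl
double-+₄ true  false = refl
double-+₄ true  true  = refl

double-*₄ : ∀ a c → double a *₄ c ≡ double (a ∧ mod2 c)
double-*₄ false c  = refl
double-*₄ true  z0 = refl
double-*₄ true  z1 = refl
double-*₄ true  z2 = refl
double-*₄ true  z3 = refl

mod2-dot : ∀ {n} (x y : Word₄ n) → mod2 (dot x y) ≡ dot₂ (map mod2 x) (map mod2 y)
mod2-dot []      []      = refl
mod2-dot (a ∷ x) (b ∷ y) =
  trans (mod2-+₄ (a *₄ b) (dot x y)) (cong₂ _xor_ (mod2-*₄ a b) (mod2-dot x y))

double-dot : ∀ {n} (t : Word₂ n) (y : Word₄ n) →
             dot (map double t) y ≡ double (dot₂ t (map mod2 y))
double-dot []      []      = refl
double-dot (a ∷ t) (c ∷ y) =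
  trans (cong₂ _+₄_ (double-*₄ a c) (double-dot t y))
        (double-+₄ (a ∧ mod2 c) (dot₂ t (map mod2 y)))

eucWt-double : ∀ {n} (t : Word₂ n) → eucWt (map double t) ≡ 4 * ∣ t ∣
eucWt-double []          = refl
eucWt-double (false ∷ t) = eucWt-double t
eucWt-double (true ∷ t)  = trans (cong (4 +_) (eucWt-double t)) (sym (*-suc 4 ∣ t ∣))

double≡zero₄ : ∀ {n} (t : Word₂ n) → map double t ≡ zero₄ → t ≡ zero₂
double≡zero₄ []          _ = refl
double≡zero₄ (false ∷ t) e = cong (false ∷_) (double≡zero₄ t (∷-injectiveʳ e))

residue-selfOrthogonal : ∀ {n} {C : Word₄ n → Set} {x y} → SelfDual C →
                         Residue C x → Residue C y → dot₂ x y ≡ false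
residue-selfOrthogonal selfDual (c , c∈C , refl) (c′ , c′∈C , refl) =
  trans (sym (mod2-dot c c′)) (cong mod2 (proj₁ (selfDual c) c∈C c′ c′∈C))

double-dualResidue : ∀ {n} {C : Word₄ n → Set} → SelfDual C →
                     ∀ t → (∀ b → Residue C b → dot₂ b t ≡ false) → C (map double t)
double-dualResidue selfDual t t⊥ = proj₂ (selfDual (map double t)) λ y y∈C →
  trans (double-dot t y) (cong double (trans (dot₂-comm t (map mod2 y)) (t⊥ _ (y , y∈C , refl))))

residue-dualDistance≥4 : ∀ {n k} {C : Word₄ n → Set} → SelfDual C →
                         (∀ x → C x → x ≢ zero₄ → 12 < eucWt x) →
                         (vs : Vec (Word₂ n) k) →
                         (∀ b → Residue C b → ∃ λ a → linComb a vs ≡ b) →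
                         DualDistance≥4 vs
residue-dualDistance≥4 {C = C} selfDual minWeight vs spans t syndrome≡zero weight≤3 =
  decidable-stable (≡-dec _≟ᵇ_ t zero₂) λ t≢zero →
    <⇒≱ (minWeight _ (double-dualResidue selfDual t t⊥residue) (t≢zero ∘ double≡zero₄ t)) eucWt≤12
  where
  t⊥residue : ∀ b → Residue C b → dot₂ b t ≡ false
  t⊥residue b b∈residue with spans b b∈residue
  ... | a , refl = linComb-orthogonal a vs t λ j → begin
    dot₂ (lookup vs j) t      ≡⟨ lookup-map j (λ v → dot₂ v t) vs ⟨
    lookup (syndrome vs t) j  ≡⟨ cong (λ s → lookup s j) syndrome≡zero ⟩
    lookup zero₂ j            ≡⟨ lookup-replicate j false ⟩
    false                     ∎
    where open ≡-Reasoning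
  eucWt≤12 : eucWt (map double t) ≤ 12
  eucWt≤12 = subst (_≤ 12) (sym (eucWt-double t)) (*-monoʳ-≤ 4 weight≤3)

residueBasis-orthogonal : ∀ {n k} {C : Word₄ n → Set} → SelfDual C →
                          (vs : Vec (Word₂ n) k) → (∀ a → Residue C (linComb a vs)) →
                          Orthogonal vs vs
residueBasis-orthogonal {C = C} selfDual vs inResidue i j =
  residue-selfOrthogonal selfDual (basis∈residue i) (basis∈residue j)
  where
  basis∈residue : ∀ i → Residue C (lookup vs i)
  basis∈residue i = subst (Residue C) (linComb-⁅⁆ vs i) (inResidue ⁅ i ⁆)

m+m≤n+n⇒m≤n : ∀ {m n} → m + m ≤ n + n → m ≤ n
m+m≤n+n⇒m≤n m+m≤n+n = ≮⇒≥ λ n<m → <⇒≱ (+-mono-< n<m n<m) m+m≤n+n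

2^m<2^n⇒m<n : ∀ {m n} → 2 ^ m < 2 ^ n → m < n
2^m<2^n⇒m<n 2^m<2^n = ≰⇒> λ n≤m → <⇒≱ 2^m<2^n (^-monoʳ-≤ 2 n≤m)

lemma2 : (n : ℕ) (C : Word₄ n → Set) → IsExtremalTypeII C → (k : ℕ) → HasDim (Residue C) k →
           ((n ≡ 32 → 6 ≤ k × k ≤ 16) × (n ≡ 40 → 7 ≤ k × k ≤ 20))
lemma2 n C ((_ , selfDual , _) , (_ , minWeight)) k (vs , independent , spans , inResidue) =
  length32 , length40
  where
  bounds : 12 < 8 * (n / 24) + 8 → n + n ≤ 2 ^ k × k + k ≤ n
  bounds d>12 =
    dualDistance≥4⇒2n≤2^k vs (residue-dualDistance≥4 selfDual minWeight>12 vs spans) ,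
    independent-orthogonal⇒≤ n vs vs independent independent
      (residueBasis-orthogonal selfDual vs inResidue)
    where
    minWeight>12 : ∀ x → C x → x ≢ zero₄ → 12 < eucWt x
    minWeight>12 x x∈C x≢0 = <-≤-trans d>12 (minWeight x x∈C x≢0)

  length32 : n ≡ 32 → 6 ≤ k × k ≤ 16
  length32 refl = let lower , upper = bounds (m<m+n 12 z<s) in
    2^m<2^n⇒m<n (<-≤-trans (m<m+n 32 z<s) lower) , m+m≤n+n⇒m≤n {n = 16} upper

  length40 : n ≡ 40 → 7 ≤ k × k ≤ 20
  length40 refl = let lower , upper = bounds (m<m+n 12 z<s) in
    2^m<2^n⇒m<n (<-≤-trans (m<m+n 64 z<s) lower) , m+m≤n+n⇒m≤n {n = 20} upper
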